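{- Let $r\ge3$ and $1<s\le r$ be integers, let $a_1,\dots,a_r\in\Omega$ be defined recursively by $a_1=(a_r,\mathrm{id})\sigma$, $a_i=(\mathrm{id},a_{i-1})$ for $2\le i\le s-1$, $a_s=(\mathrm{id},a_{s-1})\sigma$, $a_i=(a_{i-1},\mathrm{id})$ for $s+1\le i\le r$, and let $G$ be the closed subgroup of $\Omega$ topologically generated by $a_1,\dots,a_r$. Let $[G,G]$ be the closure of the commutator subgroup of $G$, $G_{\text{ab}}=G/[G,G]$, $N=N_\Omega(G)$ the normalizer of $G$ in $\Omega$, and $\varphi:N\to\mathrm{Aut}(G_{\text{ab}})$ the homomorphism given by conjugation. Assume that for every element $\gamma=(\gamma_0,\gamma_1)\in[G,G]$ (with trivial action on the first level) the product $\gamma_0\gamma_1$ lies in $[G,G]$. Then $\ker\varphi=G$.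
   Context: $T$ is the regular rooted binary tree whose vertices are finite words over $\{0,1\}$; $\Omega=\mathrm{Aut}(T)$ with its profinite topology; automorphisms act on the right and $\gamma\gamma'$ means first $\gamma$ then $\gamma'$. Every $\gamma\in\Omega$ is written uniquely as $(\gamma_0,\gamma_1)\tau$ with $\tau\in\{\mathrm{id},\sigma\}$, meaning $(xv)\gamma=(x)\tau\,(v)\gamma_x$ for a letter $x$ and word $v$; $\sigma=(\mathrm{id},\mathrm{id})\sigma$ swaps the first letter; $(\gamma_0,\gamma_1)$ abbreviates $(\gamma_0,\gamma_1)\mathrm{id}$. Multiplication: $(\gamma_0,\gamma_1)\tau\cdot(\gamma_0',\gamma_1')\tau'=(\gamma_0\gamma'_{(0)\tau},\gamma_1\gamma'_{(1)\tau})\tau\tau'$. -}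

module Defs where

open import Data.Bool using (Bool; true; false; if_then_else_; _xor_; not; _∧_; _∨_)
open import Data.Nat using (ℕ; zero; suc; _∸_; _≡ᵇ_; _≤ᵇ_; _<_)
open import Data.Fin using (Fin; toℕ)
open import Data.List using (List; []; _∷_; foldr; length)
open import Data.Product using (Σ; ∃; _×_; _,_; proj₁)
open import Relation.Binary.PropositionalEquality using (_≡_)

-- Vertices of the binary tree T: finite words over {0,1}; letter 0 = false, 1 = true.
Word : Set
Word = List Bool

-- An element of Ω = Aut(T) is represented (bijectively) by its portrait:
-- the label at vertex v is true iff the section γ_v acts as σ at the root,
-- i.e. γ_v = (γ_{v0}, γ_{v1}) τ with τ = σ iff label is true.
Aut : Set
Aut = Word → Bool

sec : Aut → Bool → Aut
sec p x v = p (x ∷ v)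

-- action on vertices (right action): (x v)γ = (x)τ (v)γ_x
act : Aut → Word → Word
act p [] = []
act p (x ∷ v) = (x xor p []) ∷ act (sec p x) v

idA : Aut
idA _ = false

-- product γγ' (first γ then γ'):  (γ_0 γ'_{(0)τ}, γ_1 γ'_{(1)τ}) ττ'
_·_ : Aut → Aut → Aut
(p · q) [] = p [] xor q []
(p · q) (x ∷ v) = (sec p x · sec q (x xor p [])) v
infixl 7 _·_

-- inverse: (γ^{-1})_y = (γ_{(y)τ})^{-1}, same root label τ
inv : Aut → Aut
inv p [] = p []
inv p (y ∷ v) = inv (sec p (y xor p [])) v

_≈_ : Aut → Aut → Set
p ≈ q = ∀ v → p v ≡ q v

-- agreement on the first n levels (i.e. γ γ'^{-1} lies in the n-th level
-- stabiliser); these cosets form a neighbourhood basis of the profinite topology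
AgreeUpTo : ℕ → Aut → Aut → Set
AgreeUpTo n p q = ∀ v → length v < n → p v ≡ q v

-- The generators a_i (1 ≤ i ≤ r), indexed by a natural number i:
--   a_1 = (a_r, id)σ,
--   a_i = (id, a_{i-1})      for 2 ≤ i ≤ s-1,
--   a_s = (id, a_{s-1})σ,
--   a_i = (a_{i-1}, id)      for s+1 ≤ i ≤ r.
-- (Values for i outside 1..r are irrelevant and never used.)
gen : (r s : ℕ) → ℕ → Aut
gen r s i [] = (i ≡ᵇ 1) ∨ (i ≡ᵇ s)
gen r s i (x ∷ v) =
  if i ≡ᵇ 1 then (if x then false else gen r s r v)
  else if i ≤ᵇ s then (if x then gen r s (i ∸ 1) v else false)
  else (if x then false else gen r s (i ∸ 1) v)

-- a_i for i : Fin r, i.e. a_{toℕ i + 1}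
a : (r s : ℕ) → Fin r → Aut
a r s i = gen r s (suc (toℕ i)) 

-- group words in a_1..a_r: a letter (i , false) is a_i, (i , true) is a_i^{-1}
GroupWord : ℕ → Set
GroupWord r = List (Fin r × Bool)

evalW : (r s : ℕ) → GroupWord r → Aut
evalW r s = foldr (λ { (i , e) acc → (if e then inv (a r s i) else a r s i) · acc }) idA

-- G = closed subgroup topologically generated by a_1..a_r
-- (= closure of the abstract subgroup ⟨a_1,…,a_r⟩)
InG : (r s : ℕ) → Aut → Set
InG r s γ = ∀ n → ∃ λ (w : GroupWord r) → AgreeUpTo n (evalW r s w) γ

comm : Aut → Aut → Aut
comm g h = inv g · inv h · g · h

ElG : (r s : ℕ) → Set
ElG r s = Σ Aut (InG r s)

prodComms : ∀ {r s} → List (ElG r s × ElG r s) → Aut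
prodComms = foldr (λ { ((g , _) , (h , _)) acc → comm g h · acc }) idA

-- [G,G] = closure of the commutator subgroup of G
-- (the abstract commutator subgroup consists of finite products of commutators,
--  since [g,h]^{-1} = [h,g])
InG' : (r s : ℕ) → Aut → Set
InG' r s γ = ∀ n → ∃ λ (cs : List (ElG r s × ElG r s)) → AgreeUpTo n (prodComms cs) γ

InN : (r s : ℕ) → Aut → Set
InN r s γ = ∀ g → InG r s g → InG r s (inv γ · g · γ) × InG r s (γ · g · inv γ)

-- kernel of φ : N → Aut(G_ab), φ(γ) = (g[G,G] ↦ γ^{-1} g γ [G,G]):
-- γ ∈ N and γ^{-1} g γ ≡ g mod [G,G] for all g ∈ G
InKerφ : (r s : ℕ) → Aut → Set
InKerφ r s γ = InN r s γ × (∀ g → InG r s g → InG' r s (inv γ · g · γ · inv g))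

-- G ⊆ ker φ is immediate. For the converse let L′ = {x | (x, 1) ∈ G}. The level-fixing
-- elements (x, y) with x, y ∈ L′ form a closed subgroup Q normalised by G which contains
-- every [a_i, a_j] (the only nontrivial case is [a₁, a_s] = [a₁, a₁ a_s], where
-- a₁ a_s = (a_r a_{s-1}, 1)); hence [G, G] ⊆ Q.
-- Let γ ∈ ker φ, multiplied by a₁⁻¹ if necessary so that γ = (γ₀, γ₁). Then γ₁ ∈ ker φ:
-- conjugating (h, h) ∈ G by γ shows that γ₁ normalises G, and for each generator a_k one
-- of a₁, a_s or (1, a_k) ∈ G yields an element of [G, G] whose two sections multiply, by
-- the hypothesis, to γ₁⁻¹ a_k γ₁ a_k⁻¹ up to conjugation and commutators in G. Moreover
-- γ₁⁻¹ γ₀ is a section of γ⁻¹ a₁ γ a₁⁻¹ ∈ [G, G] ⊆ Q, so γ = (γ₁, γ₁)(γ₁⁻¹ γ₀, 1) with the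
-- second factor in G. By induction on n every element of ker φ agrees with an element of
-- G on the first n levels, and G is closed.

module Submission where

open import Algebra.Bundles using (Group)
open import Algebra.Structures using (IsGroup)
open import Data.Bool using (Bool; true; false; _xor_; not; if_then_else_)
open import Data.Bool.Properties using (xor-assoc; xor-same; xor-identityʳ)
open import Data.Fin using (Fin; zero; suc; toℕ; fromℕ<)
open import Data.Fin.Properties using (toℕ-fromℕ<; toℕ<n) renaming (_≟_ to _≟ᶠ_)
open import Data.List using (List; []; _∷_; _++_; foldr)
open import Data.Nat using (ℕ; zero; suc; pred; _+_; _≤_; _<_; s≤s; z≤n; _≡ᵇ_; _≤ᵇ_)
open import Data.Nat.Properties
  using ( m<n⇒m<1+n; pred-mono-≤; pred[n]≤n; m≤n⇒m<n∨m≡n; ≤-refl; ≤-trans; <⇒≤; _≟_; _≤?_; ≰⇒>; <⇒≱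
        ; ≡ᵇ⇒≡; ≤ᵇ⇒≤; ≤⇒≤ᵇ)
open import Data.Empty using (⊥-elim)
open import Data.Unit using (tt)
open import Data.Product using (∃; ∃₂; _×_; _,_; proj₁; proj₂)
open import Data.Sum using (_⊎_; inj₁; inj₂)
open import Data.Vec using (Vec; lookup; _∷_; [])
open import Relation.Binary.PropositionalEquality as ≡ using (_≡_; _≢_)
open import Relation.Nullary using (yes; no)


module GroupSolver {c ℓ} (𝔾 : Group c ℓ) where

  open Group 𝔾
  open import Algebra.Properties.Group 𝔾
    using (ε⁻¹≈ε; ⁻¹-involutive; ⁻¹-anti-homo-∙; \\-leftDividesˡ; \\-leftDividesʳ)
  open import Relation.Binary.Reasoning.Setoid setoid

  infixl 7 _⊗_
  infix 8 _⁻

  data Expr (n : ℕ) : Set where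
    var  : Fin n → Expr n
    unit : Expr n
    _⊗_  : Expr n → Expr n → Expr n
    _⁻   : Expr n → Expr n

  ⟦_⟧ : ∀ {n} → Expr n → Vec Carrier n → Carrier
  ⟦ var i ⟧ ρ = lookup ρ i
  ⟦ unit ⟧ ρ = ε
  ⟦ e ⊗ e′ ⟧ ρ = ⟦ e ⟧ ρ ∙ ⟦ e′ ⟧ ρ
  ⟦ e ⁻ ⟧ ρ = ⟦ e ⟧ ρ ⁻¹

  Letter : ℕ → Set
  Letter n = Fin n × Bool

  ⟦_⟧ˡ : ∀ {n} → Letter n → Vec Carrier n → Carrier
  ⟦ i , false ⟧ˡ ρ = lookup ρ i
  ⟦ i , true ⟧ˡ ρ = lookup ρ i ⁻¹

  ⟦_⟧ʷ : ∀ {n} → List (Letter n) → Vec Carrier n → Carrier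
  ⟦ [] ⟧ʷ ρ = ε
  ⟦ l ∷ w ⟧ʷ ρ = ⟦ l ⟧ˡ ρ ∙ ⟦ w ⟧ʷ ρ

  infixr 5 _◃_

  _◃_ : ∀ {n} → Letter n → List (Letter n) → List (Letter n)
  l ◃ [] = l ∷ []
  (i , b) ◃ (j , b′) ∷ w with i ≟ᶠ j | b xor b′
  ... | yes _ | true = w
  ... | _ | _ = (i , b) ∷ (j , b′) ∷ w

  _⋯_ : ∀ {n} → List (Letter n) → List (Letter n) → List (Letter n)
  w ⋯ w′ = foldr _◃_ w′ w

  invert : ∀ {n} → List (Letter n) → List (Letter n)
  invert [] = []
  invert ((i , b) ∷ w) = invert w ⋯ ((i , not b) ∷ [])

  normalise : ∀ {n} → Expr n → List (Letter n)
  normalise (var i) = (i , false) ∷ []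
  normalise unit = []
  normalise (e ⊗ e′) = normalise e ⋯ normalise e′
  normalise (e ⁻) = invert (normalise e)

  module _ {n} (ρ : Vec Carrier n) where

    ◃-sound : ∀ l w → ⟦ l ◃ w ⟧ʷ ρ ≈ ⟦ l ⟧ˡ ρ ∙ ⟦ w ⟧ʷ ρ
    ◃-sound l [] = refl
    ◃-sound (i , b) ((j , b′) ∷ w) with i ≟ᶠ j | b xor b′ in b≠b′
    ◃-sound (i , b) ((j , b′) ∷ w) | no _ | _ = refl
    ◃-sound (i , b) ((j , b′) ∷ w) | yes _ | false = refl
    ◃-sound (i , false) ((.i , true) ∷ w) | yes ≡.refl | true = begin
      ⟦ w ⟧ʷ ρ                         ≈⟨ \\-leftDividesˡ (lookup ρ i) (⟦ w ⟧ʷ ρ) ⟨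
      lookup ρ i ∙ (lookup ρ i ⁻¹ ∙ ⟦ w ⟧ʷ ρ) ∎
    ◃-sound (i , true) ((.i , false) ∷ w) | yes ≡.refl | true = begin
      ⟦ w ⟧ʷ ρ                         ≈⟨ \\-leftDividesʳ (lookup ρ i) (⟦ w ⟧ʷ ρ) ⟨
      lookup ρ i ⁻¹ ∙ (lookup ρ i ∙ ⟦ w ⟧ʷ ρ) ∎

    ⋯-sound : ∀ w w′ → ⟦ w ⋯ w′ ⟧ʷ ρ ≈ ⟦ w ⟧ʷ ρ ∙ ⟦ w′ ⟧ʷ ρ
    ⋯-sound [] w′ = sym (identityˡ _)
    ⋯-sound (l ∷ w) w′ = begin
      ⟦ l ◃ (w ⋯ w′) ⟧ʷ ρ              ≈⟨ ◃-sound l (w ⋯ w′) ⟩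
      ⟦ l ⟧ˡ ρ ∙ ⟦ w ⋯ w′ ⟧ʷ ρ          ≈⟨ ∙-congˡ (⋯-sound w w′) ⟩
      ⟦ l ⟧ˡ ρ ∙ (⟦ w ⟧ʷ ρ ∙ ⟦ w′ ⟧ʷ ρ) ≈⟨ assoc _ _ _ ⟨
      ⟦ l ⟧ˡ ρ ∙ ⟦ w ⟧ʷ ρ ∙ ⟦ w′ ⟧ʷ ρ   ∎

    flip-sound : ∀ i b → ⟦ i , not b ⟧ˡ ρ ≈ ⟦ i , b ⟧ˡ ρ ⁻¹
    flip-sound i false = refl
    flip-sound i true = sym (⁻¹-involutive _)

    invert-sound : ∀ w → ⟦ invert w ⟧ʷ ρ ≈ ⟦ w ⟧ʷ ρ ⁻¹
    invert-sound [] = sym ε⁻¹≈ε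
    invert-sound ((i , b) ∷ w) = begin
      ⟦ invert w ⋯ ((i , not b) ∷ []) ⟧ʷ ρ     ≈⟨ ⋯-sound (invert w) _ ⟩
      ⟦ invert w ⟧ʷ ρ ∙ (⟦ i , not b ⟧ˡ ρ ∙ ε)  ≈⟨ ∙-congˡ (identityʳ _) ⟩
      ⟦ invert w ⟧ʷ ρ ∙ ⟦ i , not b ⟧ˡ ρ        ≈⟨ ∙-cong (invert-sound w) (flip-sound i b) ⟩
      ⟦ w ⟧ʷ ρ ⁻¹ ∙ ⟦ i , b ⟧ˡ ρ ⁻¹             ≈⟨ ⁻¹-anti-homo-∙ _ _ ⟨
      (⟦ i , b ⟧ˡ ρ ∙ ⟦ w ⟧ʷ ρ) ⁻¹              ∎

    normalise-sound : ∀ e → ⟦ normalise e ⟧ʷ ρ ≈ ⟦ e ⟧ ρ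
    normalise-sound (var i) = identityʳ _
    normalise-sound unit = refl
    normalise-sound (e ⊗ e′) =
      trans (⋯-sound (normalise e) (normalise e′)) (∙-cong (normalise-sound e) (normalise-sound e′))
    normalise-sound (e ⁻) = trans (invert-sound (normalise e)) (⁻¹-cong (normalise-sound e))

  solve : ∀ {n} (e e′ : Expr n) → normalise e ≡ normalise e′ → ∀ ρ → ⟦ e ⟧ ρ ≈ ⟦ e′ ⟧ ρ
  solve e e′ same ρ = begin
    ⟦ e ⟧ ρ               ≈⟨ normalise-sound ρ e ⟨
    ⟦ normalise e ⟧ʷ ρ    ≡⟨ ≡.cong (λ w → ⟦ w ⟧ʷ ρ) same ⟩
    ⟦ normalise e′ ⟧ʷ ρ   ≈⟨ normalise-sound ρ e′ ⟩
    ⟦ e′ ⟧ ρ              ∎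

  infixr 7.5 _^_

  _^_ : ∀ {n} → Expr n → Expr n → Expr n
  e ^ h = h ⁻ ⊗ e ⊗ h

  ⟪_,_⟫ : ∀ {n} → Expr n → Expr n → Expr n
  ⟪ e , e′ ⟫ = e ⁻ ⊗ e′ ⁻ ⊗ e ⊗ e′

  x₀ : ∀ {n} → Expr (suc n)
  x₀ = var zero
  x₁ : ∀ {n} → Expr (suc (suc n))
  x₁ = var (suc zero)
  x₂ : ∀ {n} → Expr (suc (suc (suc n)))
  x₂ = var (suc (suc zero))

open import Defs hiding (_≈_)
open ≡ using (refl; sym; trans; cong; cong₂)

module AutGroupLaws where

  open Defs using (_≈_)

  ·-cong : ∀ {γ γ′ δ δ′} → γ ≈ γ′ → δ ≈ δ′ → (γ · δ) ≈ (γ′ · δ′)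
  ·-cong γ≈ δ≈ [] = cong₂ _xor_ (γ≈ []) (δ≈ [])
  ·-cong {γ} {γ′} {δ} {δ′} γ≈ δ≈ (x ∷ v) =
    ·-cong {sec γ x} {sec γ′ x} {sec δ (x xor γ [])} {sec δ′ (x xor γ′ [])}
      (λ w → γ≈ (x ∷ w)) (λ w → trans (cong (λ b → δ ((x xor b) ∷ w)) (γ≈ [])) (δ≈ _)) v

  inv-cong : ∀ {γ γ′} → γ ≈ γ′ → inv γ ≈ inv γ′
  inv-cong γ≈ [] = γ≈ []
  inv-cong {γ} {γ′} γ≈ (y ∷ v) =
    inv-cong {sec γ (y xor γ [])} {sec γ′ (y xor γ′ [])}
      (λ w → trans (cong (λ b → γ ((y xor b) ∷ w)) (γ≈ [])) (γ≈ _)) v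

  ·-assoc : ∀ γ δ η → ((γ · δ) · η) ≈ (γ · (δ · η))
  ·-assoc γ δ η [] = xor-assoc (γ []) (δ []) (η [])
  ·-assoc γ δ η (x ∷ v) =
    trans (cong (λ b → ((sec γ x · sec δ (x xor γ [])) · sec η b) v) (sym (xor-assoc x (γ []) (δ []))))
          (·-assoc (sec γ x) (sec δ (x xor γ [])) (sec η ((x xor γ []) xor δ [])) v)

  ·-identityˡ : ∀ γ → (idA · γ) ≈ γ
  ·-identityˡ γ [] = refl
  ·-identityˡ γ (x ∷ v) =
    trans (cong (λ b → (idA · sec γ b) v) (xor-identityʳ x)) (·-identityˡ (sec γ x) v)

  ·-identityʳ : ∀ γ → (γ · idA) ≈ γ
  ·-identityʳ γ [] = xor-identityʳ (γ [])
  ·-identityʳ γ (x ∷ v) = ·-identityʳ (sec γ x) v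

  inv-inverseˡ : ∀ γ → (inv γ · γ) ≈ idA
  inv-inverseˡ γ [] = xor-same (γ [])
  inv-inverseˡ γ (x ∷ v) = inv-inverseˡ (sec γ (x xor γ [])) v

  inv-inverseʳ : ∀ γ → (γ · inv γ) ≈ idA
  inv-inverseʳ γ [] = xor-same (γ [])
  inv-inverseʳ γ (x ∷ v) = trans (cong (λ b → (sec γ x · inv (sec γ b)) v) (xor-cancel x (γ [])))
                                 (inv-inverseʳ (sec γ x) v)
    where
    xor-cancel : ∀ x b → (x xor b) xor b ≡ x
    xor-cancel x b = trans (xor-assoc x b b) (trans (cong (x xor_) (xor-same b)) (xor-identityʳ x))

  Aut-isGroup : IsGroup _≈_ _·_ idA inv
  Aut-isGroup = record
    { isMonoid = record
      { isSemigroup = record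
        { isMagma = record
          { isEquivalence = record
            { refl = λ _ → refl ; sym = λ e v → sym (e v) ; trans = λ e f v → trans (e v) (f v) }
          ; ∙-cong = ·-cong }
        ; assoc = ·-assoc }
      ; identity = ·-identityˡ , ·-identityʳ }
    ; inverse = inv-inverseˡ , inv-inverseʳ
    ; ⁻¹-cong = inv-cong }

Aut-group : Group _ _
Aut-group = record { isGroup = AutGroupLaws.Aut-isGroup }

open Group Aut-group using (_≈_) renaming (refl to ≈-refl; sym to ≈-sym; trans to ≈-trans)
open AutGroupLaws using (·-cong; inv-cong; ·-assoc; ·-identityˡ; ·-identityʳ)
open GroupSolver Aut-group using (Expr; unit; _⊗_; _⁻; _^_; ⟪_,_⟫; x₀; x₁; x₂; solve)

infix 4 _≈[_]_

_≈[_]_ : Aut → ℕ → Aut → Set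
γ ≈[ n ] δ = AgreeUpTo n γ δ

≈[]-refl : ∀ {n γ} → γ ≈[ n ] γ
≈[]-refl _ _ = refl

≈⇒≈[] : ∀ {n γ δ} → γ ≈ δ → γ ≈[ n ] δ
≈⇒≈[] γ≈δ v _ = γ≈δ v

≈[]-trans : ∀ {n γ δ η} → γ ≈[ n ] δ → δ ≈[ n ] η → γ ≈[ n ] η
≈[]-trans γ≈δ δ≈η v l = trans (γ≈δ v l) (δ≈η v l)

≈[]-weaken : ∀ {n γ δ} → γ ≈[ suc n ] δ → γ ≈[ n ] δ
≈[]-weaken γ≈δ v l = γ≈δ v (m<n⇒m<1+n l)

·-cong[] : ∀ {n γ γ′ δ δ′} → γ ≈[ n ] γ′ → δ ≈[ n ] δ′ → γ · δ ≈[ n ] γ′ · δ′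
·-cong[] {suc n} γ≈ δ≈ [] l = cong₂ _xor_ (γ≈ [] l) (δ≈ [] l)
·-cong[] {suc n} {γ} {γ′} {δ} {δ′} γ≈ δ≈ (x ∷ v) (s≤s l) =
  ·-cong[] {n} {sec γ x} {sec γ′ x} {sec δ (x xor γ [])} {sec δ′ (x xor γ′ [])}
    (λ w l′ → γ≈ (x ∷ w) (s≤s l′))
    (λ w l′ → trans (cong (λ b → δ ((x xor b) ∷ w)) (γ≈ [] (s≤s z≤n))) (δ≈ _ (s≤s l′))) v l

inv-cong[] : ∀ {n γ γ′} → γ ≈[ n ] γ′ → inv γ ≈[ n ] inv γ′
inv-cong[] {suc n} γ≈ [] l = γ≈ [] l
inv-cong[] {suc n} {γ} {γ′} γ≈ (y ∷ v) (s≤s l) =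
  inv-cong[] {n} {sec γ (y xor γ [])} {sec γ′ (y xor γ′ [])}
    (λ w l′ → trans (cong (λ b → γ ((y xor b) ∷ w)) (γ≈ [] (s≤s z≤n))) (γ≈ _ (s≤s l′))) v l

sec-cong[] : ∀ {n γ δ} x → γ ≈[ suc n ] δ → sec γ x ≈[ n ] sec δ x
sec-cong[] x γ≈δ w l = γ≈δ (x ∷ w) (s≤s l)


Closed : (Aut → Set) → Set
Closed P = ∀ {γ} → (∀ n → ∃ λ δ → P δ × δ ≈[ n ] γ) → P γ

closed-resp : ∀ {P} → Closed P → ∀ {γ δ} → P γ → γ ≈ δ → P δ
closed-resp closed {γ} Pγ γ≈δ = closed (λ n → γ , Pγ , ≈⇒≈[] γ≈δ)

record IsClosedSubgroup (P : Aut → Set) : Set where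
  field
    closed     : Closed P
    id-closed  : P idA
    ·-closed   : ∀ {γ δ} → P γ → P δ → P (γ · δ)
    inv-closed : ∀ {γ} → P γ → P (inv γ)

  resp : ∀ {γ δ} → P γ → γ ≈ δ → P δ
  resp = closed-resp closed

NormalisedBy : (Aut → Set) → (Aut → Set) → Set
NormalisedBy H P = ∀ {γ h} → P γ → H h → P (inv h · γ · h)

module Generated {X : Set} (f : X → Aut) where

  product : List X → Aut
  product = foldr (λ x γ → f x · γ) idA

  Closure : Aut → Set
  Closure γ = ∀ n → ∃ λ xs → product xs ≈[ n ] γ

  product-++ : ∀ xs ys → product (xs ++ ys) ≈ product xs · product ys
  product-++ [] ys = ≈-sym (·-identityˡ _)
  product-++ (x ∷ xs) ys =
    ≈-trans (·-cong ≈-refl (product-++ xs ys)) (≈-sym (·-assoc (f x) (product xs) (product ys)))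

  generator-∈ : ∀ x → Closure (f x)
  generator-∈ x n = x ∷ [] , ≈⇒≈[] (·-identityʳ (f x))

  closure-closed : Closed Closure
  closure-closed approx n =
    let (δ , δ∈ , δ≈) = approx n ; (xs , xs≈) = δ∈ n in xs , ≈[]-trans xs≈ δ≈

  closure-· : ∀ {γ δ} → Closure γ → Closure δ → Closure (γ · δ)
  closure-· γ∈ δ∈ n =
    let (xs , xs≈) = γ∈ n ; (ys , ys≈) = δ∈ n in
    xs ++ ys , ≈[]-trans (≈⇒≈[] (product-++ xs ys)) (·-cong[] xs≈ ys≈)

  closure-ind : (P : Aut → Set) → Closed P → P idA → (∀ x {γ} → P γ → P (f x · γ)) →
                ∀ {γ} → Closure γ → P γ
  closure-ind P closed P-id P-step γ∈ = closed λ n → let (xs , xs≈) = γ∈ n in _ , products-∈ xs , xs≈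
    where
    products-∈ : ∀ xs → P (product xs)
    products-∈ [] = P-id
    products-∈ (x ∷ xs) = P-step x (products-∈ xs)

  closure-id : Closure idA
  closure-id _ = [] , ≈[]-refl

  closure-conj : ∀ {h} → (∀ x → Closure (inv h · f x · h)) →
                 ∀ {γ} → Closure γ → Closure (inv h · γ · h)
  closure-conj {h} conj-f = closure-ind (λ γ → Closure (inv h · γ · h)) conj-closed
    (closed-resp closure-closed closure-id (solve unit (x₀ ⁻ ⊗ unit ⊗ x₀) refl (h ∷ [])))
    λ x {γ} γ^h∈ → closed-resp closure-closed (closure-· (conj-f x) γ^h∈)
      (solve (x₁ ^ x₀ ⊗ x₂ ^ x₀) ((x₁ ⊗ x₂) ^ x₀) refl (h ∷ f x ∷ γ ∷ []))
    where
    conj-closed : Closed (λ γ → Closure (inv h · γ · h))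
    conj-closed approx = closure-closed λ n →
      let (δ , δ∈ , δ≈) = approx n in _ , δ∈ , ·-cong[] (·-cong[] ≈[]-refl δ≈) ≈[]-refl

  closure-isClosedSubgroup : (∀ x → Closure (inv (f x))) → IsClosedSubgroup Closure
  closure-isClosedSubgroup inv-f = record
    { closed = closure-closed
    ; id-closed = closure-id
    ; ·-closed = closure-·
    ; inv-closed = closure-ind (λ γ → Closure (inv γ)) inv-closed
        (closed-resp closure-closed closure-id (solve unit (unit ⁻) refl []))
        λ x {γ} γ⁻¹∈ → closed-resp closure-closed (closure-· γ⁻¹∈ (inv-f x))
          (solve (x₁ ⁻ ⊗ x₀ ⁻) ((x₀ ⊗ x₁) ⁻) refl (f x ∷ γ ∷ [])) }
    where
    inv-closed : Closed (λ γ → Closure (inv γ))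
    inv-closed approx = closure-closed λ n → let (δ , δ∈ , δ≈) = approx n in _ , δ∈ , inv-cong[] δ≈

infix 8 ⟨_,_⟩_

⟨_,_⟩_ : Aut → Aut → Bool → Aut
⟨ γ₀ , γ₁ ⟩ τ = λ { [] → τ ; (false ∷ v) → γ₀ v ; (true ∷ v) → γ₁ v }

≈-by-sections : ∀ {γ δ} → γ [] ≡ δ [] →
                sec γ false ≈ sec δ false → sec γ true ≈ sec δ true → γ ≈ δ
≈-by-sections root _ _ [] = root
≈-by-sections _ sec₀ _ (false ∷ v) = sec₀ v
≈-by-sections _ _ sec₁ (true ∷ v) = sec₁ v

sec-cong : ∀ {γ δ} x → γ ≈ δ → sec γ x ≈ sec δ x
sec-cong x γ≈δ v = γ≈δ (x ∷ v)

node-η : ∀ γ → γ ≈ ⟨ sec γ false , sec γ true ⟩ (γ [])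
node-η γ = ≈-by-sections refl ≈-refl ≈-refl

root-false-η : ∀ {γ} → γ [] ≡ false → γ ≈ ⟨ sec γ false , sec γ true ⟩ false
root-false-η root = ≈-by-sections root ≈-refl ≈-refl

node-sec-∈ : ∀ {P : Aut → Set} {γ₀ γ₁ τ} → P γ₀ → P γ₁ → ∀ x → P (sec (⟨ γ₀ , γ₁ ⟩ τ) x)
node-sec-∈ P₀ _ false = P₀
node-sec-∈ _ P₁ true = P₁

node-cong[] : ∀ {n γ₀ γ₁ δ₀ δ₁ τ} → γ₀ ≈[ n ] δ₀ → γ₁ ≈[ n ] δ₁ →
              ⟨ γ₀ , γ₁ ⟩ τ ≈[ suc n ] ⟨ δ₀ , δ₁ ⟩ τ
node-cong[] _ _ [] _ = refl
node-cong[] sec₀ _ (false ∷ v) (s≤s l) = sec₀ v l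
node-cong[] _ sec₁ (true ∷ v) (s≤s l) = sec₁ v l

diag : Aut → Aut
diag γ = ⟨ γ , γ ⟩ false

module Subgroups (r s : ℕ) where

  G G′ : Aut → Set
  G = InG r s
  G′ = InG' r s

  -- G and G′ are, definitionally, the closures generated by letter and commutator.
  letter : Fin r × Bool → Aut
  letter (i , e) = if e then inv (a r s i) else a r s i

  commutator : ElG r s × ElG r s → Aut
  commutator ((g , _) , (h , _)) = comm g h

  module Gen = Generated letter
  module Gen′ = Generated commutator

  a∈G : ∀ i → G (a r s i)
  a∈G i = Gen.generator-∈ (i , false)

  G-isClosedSubgroup : IsClosedSubgroup G
  G-isClosedSubgroup = Gen.closure-isClosedSubgroup inv-letter
    where
    inv-letter : ∀ x → G (inv (letter x))
    inv-letter (i , false) = Gen.generator-∈ (i , true)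
    inv-letter (i , true) =
      closed-resp Gen.closure-closed (a∈G i) (solve x₀ (x₀ ⁻ ⁻) refl (a r s i ∷ []))

  module G = IsClosedSubgroup G-isClosedSubgroup

  G-minimal : ∀ {P} → IsClosedSubgroup P → (∀ i → P (a r s i)) → ∀ {γ} → G γ → P γ
  G-minimal {P} P-subgroup a∈P = Gen.closure-ind P P.closed P.id-closed λ x → P.·-closed (letter∈P x)
    where
    module P = IsClosedSubgroup P-subgroup
    letter∈P : ∀ x → P (letter x)
    letter∈P (i , false) = a∈P i
    letter∈P (i , true) = P.inv-closed (a∈P i)

  G-normal : NormalisedBy G G
  G-normal γ∈ h∈ = G.·-closed (G.·-closed (G.inv-closed h∈) γ∈) h∈

  comm-∈G′ : ∀ {g h} → G g → G h → G′ (comm g h)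
  comm-∈G′ g∈ h∈ = Gen′.generator-∈ ((_ , g∈) , (_ , h∈))

  G′-isClosedSubgroup : IsClosedSubgroup G′
  G′-isClosedSubgroup = Gen′.closure-isClosedSubgroup λ ((g , g∈) , (h , h∈)) →
    closed-resp Gen′.closure-closed (comm-∈G′ h∈ g∈)
      (solve ⟪ x₁ , x₀ ⟫ (⟪ x₀ , x₁ ⟫ ⁻) refl (g ∷ h ∷ []))

  module G′ = IsClosedSubgroup G′-isClosedSubgroup

  G′-normal : NormalisedBy G G′
  G′-normal {h = h} γ∈ h∈ = Gen′.closure-conj (λ ((g , g∈) , (k , k∈)) →
    closed-resp Gen′.closure-closed (comm-∈G′ (G-normal g∈ h∈) (G-normal k∈ h∈))
      (solve ⟪ x₁ ^ x₀ , x₂ ^ x₀ ⟫ (⟪ x₁ , x₂ ⟫ ^ x₀) refl (h ∷ g ∷ k ∷ []))) γ∈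

  G′-root : ∀ {γ} → G′ γ → γ [] ≡ false
  G′-root = Gen′.closure-ind (λ γ → γ [] ≡ false)
    (λ approx → let (δ , δ-root , δ≈) = approx 1 in trans (sym (δ≈ [] (s≤s z≤n))) δ-root)
    refl
    λ ((g , _) , (h , _)) {γ} γ-root → trans (comm-root (g []) (h [])) γ-root
    where
    comm-root : ∀ b c {d} → (((b xor c) xor b) xor c) xor d ≡ d
    comm-root false false = refl
    comm-root false true = refl
    comm-root true false = refl
    comm-root true true = refl

  FixesModulo : (Aut → Set) → Aut → Aut → Set
  FixesModulo P γ h = P (inv γ · h · γ · inv h)

  module _ {P} (P-subgroup : IsClosedSubgroup P) (P-normal : NormalisedBy G P) where

    private module P = IsClosedSubgroup P-subgroup

    fixed-isClosedSubgroup : ∀ γ → IsClosedSubgroup (λ h → G h × FixesModulo P γ h)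
    fixed-isClosedSubgroup γ = record
      { closed = λ approx →
          G.closed (λ n → let (δ , (δ∈ , _) , δ≈) = approx n in δ , δ∈ , δ≈) ,
          P.closed (λ n → let (δ , (_ , δ-fixed) , δ≈) = approx n in
            _ , δ-fixed , ·-cong[] (·-cong[] (·-cong[] ≈[]-refl δ≈) ≈[]-refl) (inv-cong[] δ≈))
      ; id-closed =
          G.id-closed , P.resp P.id-closed (solve unit (x₀ ⁻ ⊗ unit ⊗ x₀ ⊗ unit ⁻) refl (γ ∷ []))
      ; ·-closed = λ {h} {k} (h∈ , h-fixed) (k∈ , k-fixed) →
          G.·-closed h∈ k∈ ,
          P.resp (P.·-closed h-fixed (P-normal k-fixed (G.inv-closed h∈)))
            (solve (x₀ ⁻ ⊗ x₁ ⊗ x₀ ⊗ x₁ ⁻ ⊗ (x₀ ⁻ ⊗ x₂ ⊗ x₀ ⊗ x₂ ⁻) ^ x₁ ⁻)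
                   (x₀ ⁻ ⊗ (x₁ ⊗ x₂) ⊗ x₀ ⊗ (x₁ ⊗ x₂) ⁻) refl (γ ∷ h ∷ k ∷ []))
      ; inv-closed = λ {h} (h∈ , h-fixed) →
          G.inv-closed h∈ ,
          P.resp (P-normal (P.inv-closed h-fixed) h∈)
            (solve ((x₀ ⁻ ⊗ x₁ ⊗ x₀ ⊗ x₁ ⁻) ⁻ ^ x₁) (x₀ ⁻ ⊗ x₁ ⁻ ⊗ x₀ ⊗ x₁ ⁻ ⁻) refl
                   (γ ∷ h ∷ [])) }

    fixes-G : ∀ {γ} → (∀ i → FixesModulo P γ (a r s i)) → ∀ {h} → G h → FixesModulo P γ h
    fixes-G {γ} fixes-a h∈ = proj₂ (G-minimal (fixed-isClosedSubgroup γ) (λ i → a∈G i , fixes-a i) h∈)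

    fixes-sym : ∀ {γ h} → G γ → G h → FixesModulo P h γ → FixesModulo P γ h
    fixes-sym {γ} {h} γ∈ h∈ h-fixes =
      P.resp (P-normal (P.inv-closed h-fixes) (G.·-closed (G.inv-closed h∈) γ∈))
        (solve ((x₁ ⁻ ⊗ x₀ ⊗ x₁ ⊗ x₀ ⁻) ⁻ ^ (x₁ ⁻ ⊗ x₀)) (x₀ ⁻ ⊗ x₁ ⊗ x₀ ⊗ x₁ ⁻) refl
               (γ ∷ h ∷ []))

    G′-minimal : (∀ i j → P (comm (a r s i) (a r s j))) → ∀ {γ} → G′ γ → P γ
    G′-minimal comm-a∈P = Gen′.closure-ind P P.closed P.id-closed
      λ ((g , g∈) , (h , h∈)) → P.·-closed (P.resp (fixes g∈ (G.inv-closed h∈))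
        (solve (x₀ ⁻ ⊗ x₁ ⁻ ⊗ x₀ ⊗ x₁ ⁻ ⁻) ⟪ x₀ , x₁ ⟫ refl (g ∷ h ∷ [])))
      where
      a-fixes-a : ∀ i j → FixesModulo P (a r s i) (a r s j)
      a-fixes-a i j = P.resp (P-normal (comm-a∈P j i) (G.inv-closed (a∈G j)))
        (solve (⟪ x₁ , x₀ ⟫ ^ x₁ ⁻) (x₀ ⁻ ⊗ x₁ ⊗ x₀ ⊗ x₁ ⁻) refl (a r s i ∷ a r s j ∷ []))
      fixes : ∀ {g h} → G g → G h → FixesModulo P g h
      fixes g∈ = fixes-G λ j → fixes-sym g∈ (a∈G j) (fixes-G (a-fixes-a j) g∈)

module _ {r s : ℕ} where

  private
    ≢⇒≡ᵇ-false : ∀ {m n} → m ≢ n → (m ≡ᵇ n) ≡ false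
    ≢⇒≡ᵇ-false {m} {n} m≢n with m ≡ᵇ n | ≡ᵇ⇒≡ m n
    ... | false | _ = refl
    ... | true | m≡n = ⊥-elim (m≢n (m≡n tt))

    ≤⇒≤ᵇ-true : ∀ {m n} → m ≤ n → (m ≤ᵇ n) ≡ true
    ≤⇒≤ᵇ-true {m} {n} m≤n with m ≤ᵇ n | ≤⇒≤ᵇ m≤n
    ... | true | _ = refl

    ≡ᵇ-refl : ∀ n → (n ≡ᵇ n) ≡ true
    ≡ᵇ-refl zero = refl
    ≡ᵇ-refl (suc n) = ≡ᵇ-refl n

    >⇒≤ᵇ-false : ∀ {m n} → n < m → (m ≤ᵇ n) ≡ false
    >⇒≤ᵇ-false {m} {n} n<m with m ≤ᵇ n | ≤ᵇ⇒≤ m n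
    ... | false | _ = refl
    ... | true | m≤n = ⊥-elim (<⇒≱ n<m (m≤n tt))

  gen-1 : gen r s 1 ≈ ⟨ gen r s r , idA ⟩ true
  gen-1 = ≈-by-sections refl (λ _ → refl) (λ _ → refl)

  gen-s : 1 < s → gen r s s ≈ ⟨ idA , gen r s (pred s) ⟩ true
  gen-s (s≤s (s≤s {n = t} _)) = ≈-by-sections root sec₀ sec₁
    where
    root : gen r (2 + t) (2 + t) [] ≡ true
    root rewrite ≡ᵇ-refl t = refl
    sec₀ : ∀ v → gen r (2 + t) (2 + t) (false ∷ v) ≡ false
    sec₀ v rewrite ≤⇒≤ᵇ-true (≤-refl {2 + t}) = refl
    sec₁ : ∀ v → gen r (2 + t) (2 + t) (true ∷ v) ≡ gen r (2 + t) (1 + t) v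
    sec₁ v rewrite ≤⇒≤ᵇ-true (≤-refl {2 + t}) = refl

  gen-inner : ∀ {j} → 1 ≤ j → suc j ≢ s →
              gen r s (suc j) ≈ ⟨ idA , gen r s j ⟩ false ⊎ gen r s (suc j) ≈ ⟨ gen r s j , idA ⟩ false
  gen-inner {suc j} _ ≢s with 2 + j ≤? s
  ... | yes ≤s = inj₁ (≈-by-sections (≢⇒≡ᵇ-false ≢s) sec₀ sec₁)
    where
    sec₀ : ∀ v → gen r s (2 + j) (false ∷ v) ≡ false
    sec₀ v rewrite ≤⇒≤ᵇ-true ≤s = refl
    sec₁ : ∀ v → gen r s (2 + j) (true ∷ v) ≡ gen r s (1 + j) v
    sec₁ v rewrite ≤⇒≤ᵇ-true ≤s = refl
  ... | no ≰s = inj₂ (≈-by-sections (≢⇒≡ᵇ-false ≢s) sec₀ sec₁)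
    where
    sec₀ : ∀ v → gen r s (2 + j) (false ∷ v) ≡ gen r s (1 + j) v
    sec₀ v rewrite >⇒≤ᵇ-false (≰⇒> ≰s) = refl
    sec₁ : ∀ v → gen r s (2 + j) (true ∷ v) ≡ false
    sec₁ v rewrite >⇒≤ᵇ-false (≰⇒> ≰s) = refl

module _ {r s : ℕ} (1<s : 1 < s) (s≤r : s ≤ r) where

  open Subgroups r s

  private
    α : ℕ → Aut
    α = gen r s

    1≤r : 1 ≤ r
    1≤r = ≤-trans (<⇒≤ 1<s) s≤r

  α-∈G : ∀ {k} → 1 ≤ k → k ≤ r → G (α k)
  α-∈G {suc j} _ j<r = ≡.subst (λ k → G (α (suc k))) (toℕ-fromℕ< j<r) (a∈G (fromℕ< j<r))

  α₁-∈G : G (α 1)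
  α₁-∈G = α-∈G ≤-refl 1≤r

  αr-∈G : G (α r)
  αr-∈G = α-∈G 1≤r ≤-refl

  αs₋₁-∈G : G (α (pred s))
  αs₋₁-∈G = α-∈G (pred-mono-≤ 1<s) (≤-trans pred[n]≤n s≤r)

  α₁-node-∈G : G (⟨ α r , idA ⟩ true)
  α₁-node-∈G = G.resp α₁-∈G gen-1

  αs-∈G : G (α s)
  αs-∈G = α-∈G (<⇒≤ 1<s) s≤r

  αs-node-∈G : G (⟨ idA , α (pred s) ⟩ true)
  αs-node-∈G = G.resp αs-∈G (gen-s 1<s)

  data Position : ℕ → Set where
    at-1  : Position 1
    at-s  : Position s
    inner : ∀ {j} → 1 ≤ j → suc j ≢ s → Position (suc j)

  position : ∀ {k} → 1 ≤ k → Position k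
  position {suc zero} _ = at-1
  position {suc (suc j)} _ with 2 + j ≟ s
  ... | yes refl = at-s
  ... | no ≢s = inner (s≤s z≤n) ≢s

  L′ : Aut → Set
  L′ x = G (⟨ x , idA ⟩ false)

  L′-from-right : ∀ {x} → G (⟨ idA , x ⟩ false) → L′ x
  L′-from-right {x} x∈ = G.resp (G-normal x∈ α₁-node-∈G)
    (≈-by-sections refl (solve (unit ⁻ ⊗ x₀ ⊗ unit) x₀ refl (x ∷ []))
                        (solve (x₀ ⁻ ⊗ unit ⊗ x₀) unit refl (α r ∷ [])))

  L′-to-right : ∀ {x} → L′ x → G (⟨ idA , x ⟩ false)
  L′-to-right {x} x∈ = G.resp (G-normal x∈ (G.inv-closed α₁-node-∈G))
    (≈-by-sections refl (solve (x₀ ⁻ ⁻ ⊗ unit ⊗ x₀ ⁻) unit refl (α r ∷ []))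
                        (solve (unit ⁻ ⁻ ⊗ x₀ ⊗ unit ⁻) x₀ refl (x ∷ [])))

  L′-α : ∀ {j} → 1 ≤ j → j < r → suc j ≢ s → L′ (α j)
  L′-α 1≤j j<r ≢s with gen-inner 1≤j ≢s
  ... | inj₁ right = L′-from-right (G.resp (α-∈G (s≤s z≤n) j<r) right)
  ... | inj₂ left = G.resp (α-∈G (s≤s z≤n) j<r) left

  -- α k is a section of α 1 (k = r), of α s (k = s - 1), or of ⟨ idA , α k ⟩ false ∈ G.
  data Parent : ℕ → Set where
    of-1  : Parent r
    of-s  : Parent (pred s)
    in-L′ : ∀ {k} → L′ (α k) → Parent k

  parent : ∀ {k} → 1 ≤ k → k ≤ r → Parent k
  parent {k} 1≤k k≤r with m≤n⇒m<n∨m≡n k≤r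
  ... | inj₂ refl = of-1
  ... | inj₁ k<r with position {suc k} (s≤s z≤n)
  ...   | at-s = of-s
  ...   | inner _ ≢s = in-L′ (L′-α 1≤k k<r ≢s)
  parent () _ | inj₁ _ | at-1

  diag-∈G : ∀ {γ} → G γ → G (diag γ)
  diag-∈G = G-minimal record
    { closed = λ approx → G.closed λ n →
        let (δ , δ∈ , δ≈) = approx n in _ , δ∈ , ≈[]-weaken (node-cong[] δ≈ δ≈)
    ; id-closed = G.resp G.id-closed (≈-by-sections refl ≈-refl ≈-refl)
    ; ·-closed = λ γ∈ δ∈ → G.resp (G.·-closed γ∈ δ∈) (≈-by-sections refl ≈-refl ≈-refl)
    ; inv-closed = λ γ∈ → G.resp (G.inv-closed γ∈) (≈-by-sections refl ≈-refl ≈-refl) }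
    λ i → diag-α (parent (s≤s z≤n) (toℕ<n i))
    where
    diag-α : ∀ {k} → Parent k → G (diag (α k))
    diag-α of-1 =
      G.resp (G.·-closed α₁-node-∈G α₁-node-∈G) (≈-by-sections refl (·-identityʳ _) (·-identityˡ _))
    diag-α of-s =
      G.resp (G.·-closed αs-node-∈G αs-node-∈G) (≈-by-sections refl (·-identityˡ _) (·-identityʳ _))
    diag-α (in-L′ x∈) =
      G.resp (G.·-closed x∈ (L′-to-right x∈)) (≈-by-sections refl (·-identityʳ _) (·-identityˡ _))

  sec-∈G : ∀ {γ} → G γ → ∀ x → G (sec γ x)
  sec-∈G γ∈ =
    proj₂ (G-minimal sections-subgroup (λ i → a∈G i , α-sections (position (s≤s z≤n)) (toℕ<n i)) γ∈)
    where
    sections-subgroup : IsClosedSubgroup (λ γ → G γ × ∀ x → G (sec γ x))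
    sections-subgroup = record
      { closed = λ approx →
          G.closed (λ n → let (δ , (δ∈ , _) , δ≈) = approx n in δ , δ∈ , δ≈) ,
          λ x → G.closed λ n →
            let (δ , (_ , δ-sec∈) , δ≈) = approx (suc n) in _ , δ-sec∈ x , sec-cong[] x δ≈
      ; id-closed = G.id-closed , λ _ → G.id-closed
      ; ·-closed = λ (γ∈ , γ-sec∈) (δ∈ , δ-sec∈) →
          G.·-closed γ∈ δ∈ , λ x → G.·-closed (γ-sec∈ x) (δ-sec∈ _)
      ; inv-closed = λ (γ∈ , γ-sec∈) → G.inv-closed γ∈ , λ x → G.inv-closed (γ-sec∈ _) }
    node-sections : ∀ {γ γ₀ γ₁ τ} → γ ≈ ⟨ γ₀ , γ₁ ⟩ τ → G γ₀ → G γ₁ → ∀ x → G (sec γ x)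
    node-sections γ≈ γ₀∈ γ₁∈ x = G.resp (node-sec-∈ {G} γ₀∈ γ₁∈ x) (≈-sym (sec-cong x γ≈))
    α-sections : ∀ {k} → Position k → k ≤ r → ∀ x → G (sec (α k) x)
    α-sections at-1 _ = node-sections gen-1 αr-∈G G.id-closed
    α-sections at-s _ = node-sections (gen-s 1<s) G.id-closed αs₋₁-∈G
    α-sections (inner 1≤j ≢s) j<r with gen-inner 1≤j ≢s
    ... | inj₁ right = node-sections right G.id-closed (α-∈G 1≤j (<⇒≤ j<r))
    ... | inj₂ left = node-sections left (α-∈G 1≤j (<⇒≤ j<r)) G.id-closed

  L′⊆G : ∀ {x} → L′ x → G x
  L′⊆G x∈ = sec-∈G x∈ false

  L′-isClosedSubgroup : IsClosedSubgroup L′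
  L′-isClosedSubgroup = record
    { closed = λ approx → G.closed λ n →
        let (δ , δ∈ , δ≈) = approx n in _ , δ∈ , ≈[]-weaken (node-cong[] δ≈ ≈[]-refl)
    ; id-closed = G.resp G.id-closed (≈-by-sections refl ≈-refl ≈-refl)
    ; ·-closed = λ x∈ y∈ →
        G.resp (G.·-closed x∈ y∈) (≈-by-sections refl ≈-refl (solve (unit ⊗ unit) unit refl []))
    ; inv-closed = λ x∈ →
        G.resp (G.inv-closed x∈) (≈-by-sections refl ≈-refl (solve (unit ⁻) unit refl [])) }

  module L′ = IsClosedSubgroup L′-isClosedSubgroup

  L′-normal : NormalisedBy G L′
  L′-normal {h = h} x∈ h∈ = G.resp (G-normal x∈ (diag-∈G h∈))
    (≈-by-sections refl ≈-refl (solve (unit ^ x₀) unit refl (h ∷ [])))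

  Q : Aut → Set
  Q γ = ∃₂ λ x y → L′ x × L′ y × γ ≈ ⟨ x , y ⟩ false

  Q-isClosedSubgroup : IsClosedSubgroup Q
  Q-isClosedSubgroup = record
    { closed = λ {γ} approx →
        let (_ , (_ , _ , _ , _ , δ≈) , δ≈γ) = approx 1
            root : γ [] ≡ false
            root = trans (sym (δ≈γ [] (s≤s z≤n))) (δ≈ [])
            section-∈ : ∀ x → L′ (sec γ x)
            section-∈ x = L′.closed λ n →
              let (_ , (_ , _ , δ₀∈ , δ₁∈ , δ≈) , δ≈γ) = approx (suc n) in
              _ , node-sec-∈ {L′} δ₀∈ δ₁∈ x ,
              ≈[]-trans (≈⇒≈[] (≈-sym (sec-cong x δ≈))) (sec-cong[] x δ≈γ)
        in _ , _ , section-∈ false , section-∈ true , root-false-η root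
    ; id-closed = _ , _ , L′.id-closed , L′.id-closed , ≈-by-sections refl ≈-refl ≈-refl
    ; ·-closed = λ (_ , _ , x∈ , y∈ , γ≈) (_ , _ , x′∈ , y′∈ , δ≈) →
        _ , _ , L′.·-closed x∈ x′∈ , L′.·-closed y∈ y′∈ ,
        ≈-trans (·-cong γ≈ δ≈) (≈-by-sections refl ≈-refl ≈-refl)
    ; inv-closed = λ (_ , _ , x∈ , y∈ , γ≈) →
        _ , _ , L′.inv-closed x∈ , L′.inv-closed y∈ ,
        ≈-trans (inv-cong γ≈) (≈-by-sections refl ≈-refl ≈-refl) }

  module Q = IsClosedSubgroup Q-isClosedSubgroup

  Q-normal : NormalisedBy G Q
  Q-normal {γ} {h} (_ , _ , x∈ , y∈ , γ≈) h∈ =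
    Q.resp (conj-node (h []) (sec-∈G h∈ false) (sec-∈G h∈ true) x∈ y∈)
           (≈-sym (·-cong (·-cong (inv-cong (node-η h)) γ≈) (node-η h)))
    where
    conj-node : ∀ τ {h₀ h₁ x y} → G h₀ → G h₁ → L′ x → L′ y →
                Q (inv (⟨ h₀ , h₁ ⟩ τ) · ⟨ x , y ⟩ false · ⟨ h₀ , h₁ ⟩ τ)
    conj-node false h₀∈ h₁∈ x∈ y∈ =
      _ , _ , L′-normal x∈ h₀∈ , L′-normal y∈ h₁∈ , ≈-by-sections refl ≈-refl ≈-refl
    conj-node true h₀∈ h₁∈ x∈ y∈ =
      _ , _ , L′-normal y∈ h₁∈ , L′-normal x∈ h₀∈ , ≈-by-sections refl ≈-refl ≈-refl

  comm-∈Q : ∀ {h q} → G h → Q q → Q (comm h q)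
  comm-∈Q {h} {q} h∈ q∈ = Q.resp (Q.·-closed (Q-normal (Q.inv-closed q∈) h∈) q∈)
    (solve (x₁ ⁻ ^ x₀ ⊗ x₁) ⟪ x₀ , x₁ ⟫ refl (h ∷ q ∷ []))

  comm-∈Q′ : ∀ {q h} → Q q → G h → Q (comm q h)
  comm-∈Q′ {q} {h} q∈ h∈ = Q.resp (Q.inv-closed (comm-∈Q h∈ q∈))
    (solve (⟪ x₁ , x₀ ⟫ ⁻) ⟪ x₀ , x₁ ⟫ refl (q ∷ h ∷ []))

  α₁αs-∈Q : Q (α 1 · α s)
  α₁αs-∈Q = _ , _ , G.resp (G.·-closed α₁-node-∈G αs-node-∈G) α₁αs≈ , L′.id-closed ,
            ≈-trans (·-cong gen-1 (gen-s 1<s)) α₁αs≈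
    where
    α₁αs≈ : ⟨ α r , idA ⟩ true · ⟨ idA , α (pred s) ⟩ true ≈ ⟨ α r · α (pred s) , idA ⟩ false
    α₁αs≈ = ≈-by-sections refl ≈-refl (solve (unit ⊗ unit) unit refl [])

  α₁-comm-αs-∈Q : Q (comm (α 1) (α s))
  α₁-comm-αs-∈Q = Q.resp (comm-∈Q α₁-∈G α₁αs-∈Q)
    (solve ⟪ x₀ , x₀ ⊗ x₁ ⟫ ⟪ x₀ , x₁ ⟫ refl (α 1 ∷ α s ∷ []))

  inner-∈Q : ∀ {j} → 1 ≤ j → suc j ≢ s → j < r → Q (α (suc j))
  inner-∈Q 1≤j ≢s j<r with gen-inner 1≤j ≢s
  ... | inj₁ right = _ , _ , L′.id-closed , L′-α 1≤j j<r ≢s , right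
  ... | inj₂ left = _ , _ , L′-α 1≤j j<r ≢s , L′.id-closed , left

  comm-α-∈Q : ∀ {k l} → 1 ≤ k → k ≤ r → 1 ≤ l → l ≤ r → Q (comm (α k) (α l))
  comm-α-∈Q 1≤k k≤r 1≤l l≤r with position 1≤k | position 1≤l
  ... | _ | inner 1≤j ≢s = comm-∈Q (α-∈G 1≤k k≤r) (inner-∈Q 1≤j ≢s l≤r)
  ... | inner 1≤j ≢s | _ = comm-∈Q′ (inner-∈Q 1≤j ≢s k≤r) (α-∈G 1≤l l≤r)
  ... | at-1 | at-1 = Q.resp Q.id-closed (solve unit ⟪ x₀ , x₀ ⟫ refl (α 1 ∷ []))
  ... | at-s | at-s = Q.resp Q.id-closed (solve unit ⟪ x₀ , x₀ ⟫ refl (α s ∷ []))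
  ... | at-1 | at-s = α₁-comm-αs-∈Q
  ... | at-s | at-1 = Q.resp (Q.inv-closed α₁-comm-αs-∈Q)
                              (solve (⟪ x₀ , x₁ ⟫ ⁻) ⟪ x₁ , x₀ ⟫ refl (α 1 ∷ α s ∷ []))

  G′⊆Q : ∀ {γ} → G′ γ → Q γ
  G′⊆Q = G′-minimal Q-isClosedSubgroup Q-normal λ i j →
    comm-α-∈Q (s≤s z≤n) (toℕ<n i) (s≤s z≤n) (toℕ<n j)

  Q-sec : ∀ {γ} → Q γ → ∀ x → L′ (sec γ x)
  Q-sec (_ , _ , x∈ , y∈ , γ≈) x = L′.resp (node-sec-∈ {L′} x∈ y∈ x) (≈-sym (sec-cong x γ≈))

  K : Aut → Set
  K = InKerφ r s

  G-fixes : ∀ {γ h} → G γ → G h → FixesModulo G′ γ h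
  G-fixes {γ} {h} γ∈ h∈ = G′.resp (comm-∈G′ γ∈ (G.inv-closed h∈))
    (solve ⟪ x₀ , x₁ ⁻ ⟫ (x₀ ⁻ ⊗ x₁ ⊗ x₀ ⊗ x₁ ⁻) refl (γ ∷ h ∷ []))

  G⊆K : ∀ {γ} → G γ → K γ
  G⊆K {γ} γ∈ =
    (λ h h∈ → G-normal h∈ γ∈ ,
              G.resp (G-normal h∈ (G.inv-closed γ∈))
                     (solve (x₁ ^ x₀ ⁻) (x₀ ⊗ x₁ ⊗ x₀ ⁻) refl (γ ∷ h ∷ []))) ,
    λ h h∈ → G-fixes γ∈ h∈

  K·G⊆K : ∀ {γ h} → K γ → G h → K (γ · h)
  K·G⊆K {γ} {h} (normalises , fixes) h∈ =
    (λ g g∈ → G.resp (G-normal (proj₁ (normalises g g∈)) h∈)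
                     (solve ((x₂ ^ x₀) ^ x₁) (x₂ ^ (x₀ ⊗ x₁)) refl (γ ∷ h ∷ g ∷ [])) ,
              G.resp (proj₂ (normalises _ (G-normal g∈ (G.inv-closed h∈))))
                     (solve (x₀ ⊗ x₂ ^ x₁ ⁻ ⊗ x₀ ⁻) ((x₀ ⊗ x₁) ⊗ x₂ ⊗ (x₀ ⊗ x₁) ⁻) refl
                            (γ ∷ h ∷ g ∷ []))) ,
    λ g g∈ → G′.resp (G′.·-closed (G′-normal (fixes g g∈) h∈) (G-fixes h∈ g∈))
                     (solve ((x₀ ⁻ ⊗ x₂ ⊗ x₀ ⊗ x₂ ⁻) ^ x₁ ⊗ (x₁ ⁻ ⊗ x₂ ⊗ x₁ ⊗ x₂ ⁻))
                            ((x₀ ⊗ x₁) ⁻ ⊗ x₂ ⊗ (x₀ ⊗ x₁) ⊗ x₂ ⁻) refl (γ ∷ h ∷ g ∷ []))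

  SectionProductHypothesis : Set
  SectionProductHypothesis = ∀ γ → G′ γ → γ [] ≡ false → G′ (sec γ false · sec γ true)

  module _ {γ} (γ∈K : K γ) (root : γ [] ≡ false) where

    private
      γ₀ γ₁ X N : Aut
      γ₀ = sec γ false
      γ₁ = sec γ true
      X = inv γ₁ · γ₀
      N = ⟨ γ₀ , γ₁ ⟩ false

      γ≈N : γ ≈ N
      γ≈N = root-false-η root

      fixes-node : ∀ {h h′} → G h → h ≈ h′ → G′ (inv N · h′ · N · inv h′)
      fixes-node h∈ h≈ =
        G′.resp (proj₂ γ∈K _ h∈) (·-cong (·-cong (·-cong (inv-cong γ≈N) h≈) γ≈N) (inv-cong h≈))

    sections-quotient-∈L′ : L′ X
    sections-quotient-∈L′ = L′.resp (Q-sec (G′⊆Q (fixes-node α₁-∈G gen-1)) true)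
      (solve (x₀ ⁻ ⊗ unit ⊗ x₁ ⊗ unit ⁻) (x₀ ⁻ ⊗ x₁) refl (γ₁ ∷ γ₀ ∷ []))

    section-normalises : InN r s γ₁
    section-normalises h h∈ =
      let (conj∈ , conj′∈) = proj₁ γ∈K _ (diag-∈G h∈) in
      sec-∈G (G.resp conj∈ (·-cong (·-cong (inv-cong γ≈N) ≈-refl) γ≈N)) true ,
      sec-∈G (G.resp conj′∈ (·-cong (·-cong γ≈N ≈-refl) (inv-cong γ≈N))) true

    section-fixes : SectionProductHypothesis → ∀ {h} → G h → FixesModulo G′ γ₁ h
    section-fixes hyp = fixes-G G′-isClosedSubgroup G′-normal λ i → fixes-α (parent (s≤s z≤n) (toℕ<n i))
      where
      X∈G : G X
      X∈G = L′⊆G sections-quotient-∈L′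

      sections-product : ∀ {h h′} → G h → h ≈ h′ →
                         G′ (sec (inv N · h′ · N · inv h′) false · sec (inv N · h′ · N · inv h′) true)
      sections-product h∈ h≈ = hyp _ (fixes-node h∈ h≈) (G′-root (fixes-node h∈ h≈))

      X̂ fixed : Expr 3
      X̂ = x₁ ⁻ ⊗ x₀
      fixed = x₁ ⁻ ⊗ x₂ ⊗ x₁ ⊗ x₂ ⁻

      fixes-α : ∀ {k} → Parent k → FixesModulo G′ γ₁ (α k)
      fixes-α of-1 =
        G′.resp (G′-normal (sections-product α₁-∈G gen-1) (G.inv-closed X∈G))
          (solve ((x₀ ⁻ ⊗ x₂ ⊗ x₁ ⊗ x₂ ⁻ ⊗ (x₁ ⁻ ⊗ unit ⊗ x₀ ⊗ unit ⁻)) ^ X̂ ⁻) fixed refl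
                 (γ₀ ∷ γ₁ ∷ α r ∷ []))
      fixes-α of-s =
        G′.resp (G′.·-closed (G′-normal (sections-product αs-∈G (gen-s 1<s)) (G.inv-closed X∈G))
                             (G-fixes (G.inv-closed X∈G) αs₋₁-∈G))
          (solve ((x₀ ⁻ ⊗ unit ⊗ x₁ ⊗ unit ⁻ ⊗ (x₁ ⁻ ⊗ x₂ ⊗ x₀ ⊗ x₂ ⁻)) ^ X̂ ⁻ ⊗
                  (X̂ ⁻ ⁻ ⊗ x₂ ⊗ X̂ ⁻ ⊗ x₂ ⁻))
                 fixed refl (γ₀ ∷ γ₁ ∷ α (pred s) ∷ []))
      fixes-α (in-L′ {k} x∈) =
        G′.resp (sections-product (L′-to-right x∈) ≈-refl)
          (solve (x₀ ⁻ ⊗ unit ⊗ x₀ ⊗ unit ⁻ ⊗ (x₁ ⁻ ⊗ x₂ ⊗ x₁ ⊗ x₂ ⁻)) fixed refl (γ₀ ∷ γ₁ ∷ α k ∷ []))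

    section-∈K : SectionProductHypothesis → K γ₁
    section-∈K hyp = section-normalises , λ h h∈ → section-fixes hyp h∈

    diag-decomposition : γ ≈ diag γ₁ · ⟨ X , idA ⟩ false
    diag-decomposition = ≈-trans γ≈N
      (≈-by-sections refl (solve x₀ (x₁ ⊗ (x₁ ⁻ ⊗ x₀)) refl (γ₀ ∷ γ₁ ∷ [])) (≈-sym (·-identityʳ γ₁)))

  module _ (hyp : SectionProductHypothesis) where

    Approximable : ℕ → Set
    Approximable n = ∀ {γ} → K γ → ∃ λ δ → G δ × δ ≈[ n ] γ

    descend : ∀ {n} → Approximable n → ∀ {γ} → K γ → γ [] ≡ false → ∃ λ δ → G δ × δ ≈[ suc n ] γ
    descend approx γ∈K root =
      let (δ₁ , δ₁∈ , δ₁≈) = approx (section-∈K γ∈K root hyp) in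
      diag δ₁ · ⟨ _ , idA ⟩ false ,
      G.·-closed (diag-∈G δ₁∈) (sections-quotient-∈L′ γ∈K root) ,
      ≈[]-trans (·-cong[] (node-cong[] δ₁≈ δ₁≈) ≈[]-refl) (≈⇒≈[] (≈-sym (diag-decomposition γ∈K root)))

    approximable : ∀ n → Approximable n
    approximable zero γ∈K = idA , G.id-closed , λ _ ()
    approximable (suc n) {γ} γ∈K with γ [] in root
    ... | false = descend (approximable n) γ∈K root
    ... | true =
      let (δ , δ∈ , δ≈) =
            descend (approximable n) (K·G⊆K γ∈K (G.inv-closed α₁-∈G)) (cong (_xor true) root) in
      δ · α 1 , G.·-closed δ∈ α₁-∈G ,
      ≈[]-trans (·-cong[] δ≈ ≈[]-refl) (≈⇒≈[] (solve (x₀ ⊗ x₁ ⁻ ⊗ x₁) x₀ refl (γ ∷ α 1 ∷ [])))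

    K⊆G : ∀ {γ} → K γ → G γ
    K⊆G γ∈K = G.closed λ n → approximable n γ∈K

proposition7p3 : (r s : ℕ) → 3 ≤ r → 1 < s → s ≤ r
    → (∀ γ → InG' r s γ → γ [] ≡ false → InG' r s (sec γ false · sec γ true))
    → (∀ γ → InKerφ r s γ → InG r s γ) × (∀ γ → InG r s γ → InKerφ r s γ)
proposition7p3 r s _ 1<s s≤r hyp = (λ _ → K⊆G 1<s s≤r hyp) , (λ _ → G⊆K 1<s s≤r)
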